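{- Let $n\ge2$ and $k\ge1$ be integers. Set $\mathscr{L}_{n,k}:=|L^{\mathrm{Fib}}(n,k)|$, $\mathscr{F}_{n,k}:=n^{k\bmod 2}\,\overline{F}_k(n^2)$, and $\mathscr{A}_{n,k}:=A^{(n)}_k(1)$. Then for each $\mathscr{X}\in\{\mathscr{L},\mathscr{F},\mathscr{A}\}$ we have $\mathscr{X}_{n,k}=n\mathscr{X}_{n,k-1}-\mathscr{X}_{n,k-2}$, with $\mathscr{X}_{n,-1}=0$ and $\mathscr{X}_{n,0}=1$. In particular $\mathscr{L}_{n,k}=\mathscr{F}_{n,k}=\mathscr{A}_{n,k}$.
   Context: For $n\ge2$, $k\ge1$, $L^{\mathrm{Fib}}(n,k)$ is the set of integer $k$-tuples $T=(T_1,\ldots,T_k)$ with $T_j\in\{(j-1)n+1,\ldots,jn\}$ for all $j$ and $T_{j+1}\neq T_j+1$ for $1\le j\le k-1$; $L^{\mathrm{Fib}}(n,0)$ is a one-element set and $L^{\mathrm{Fib}}(n,-1)$ is empty. Sign-alternating Fibonacci array polynomials: with $f_{k,j}:=\binom{k-j}{j}$, set $\overline{F}_k(x):=\sum_{j=0}^{\lfloor k/2\rfloor}(-1)^jf_{k,j}\,x^{\lfloor k/2\rfloor-j}$ for $k\ge0$ and $\overline{F}_{ -1}(x):=0$. Symmetric Fibonacci triangle: for $k\ge0$ let $\mathcal{R}_{n,k}:=\{ -k(n-1),-k(n-1)+2,\ldots,k(n-1)\}$; $a^{(n)}_{k,r}=0$ for $r\notin\mathcal{R}_{n,k}$, $a^{(n)}_{0,0}=1$,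 $a^{(n)}_{1,r}=1$ for $r\in\mathcal{R}_{n,1}$, and for $k\ge2$, $a^{(n)}_{k,r}=\sum_{s\in\mathcal{R}_{n,1}}a^{(n)}_{k-1,r+s}-a^{(n)}_{k-2,r}$ for $r\in\mathcal{R}_{n,k}$. Then $A^{(n)}_k(x):=\sum_{r\in\mathcal{R}_{n,k}}a^{(n)}_{k,r}x^{(k(n-1)-r)/2}$ and $A^{(n)}_{ -1}(x):=0$. -}

module Defs where

open import Data.Nat as ℕ using (ℕ; zero; suc; _∸_; _≡ᵇ_)
open import Data.Nat.Combinatorics using (_C_)
open import Data.Integer as ℤ using (ℤ; +_; -_; _-_)
open import Data.Bool using (Bool; true; false; not; _∧_; if_then_else_)
open import Data.List using (List; []; _∷_; map; length; concatMap; filterᵇ; upTo; foldr)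
open import Data.Bool.ListAction using (any)
open import Relation.Nullary.Decidable using (⌊_⌋)

sum : List ℤ → ℤ
sum = foldr ℤ._+_ (+ 0)

block : ℕ → ℕ → List ℕ
block n j = map (λ i → (j ∸ 1) ℕ.* n ℕ.+ suc i) (upTo n)

cartesian : List (List ℕ) → List (List ℕ)
cartesian []         = [] ∷ []
cartesian (xs ∷ xss) = concatMap (λ x → map (x ∷_) (cartesian xss)) xs

-- all integer k-tuples with T_j ∈ {(j-1)n+1, …, jn}
boxTuples : ℕ → ℕ → List (List ℕ)
boxTuples n k = cartesian (map (λ i → block n (suc i)) (upTo k))

noSucc : List ℕ → Bool
noSucc (x ∷ y ∷ r) = not (y ≡ᵇ suc x) ∧ noSucc (y ∷ r)
noSucc _           = true

LFib : ℕ → ℕ → List (List ℕ)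
LFib n k = filterᵇ noSucc (boxTuples n k)

𝓛 : ℕ → ℕ → ℤ
𝓛 n k = + length (LFib n k)

𝓛₋₁ : ℕ → ℤ
𝓛₋₁ n = + length {A = List ℕ} []

sign : ℕ → ℤ
sign zero          = + 1
sign (suc zero)    = - (+ 1)
sign (suc (suc j)) = sign j

Fbar : ℕ → ℤ → ℤ
Fbar k x = sum (map (λ j → sign j ℤ.* (+ ((k ∸ j) C j)) ℤ.* (x ℤ.^ (ℕ._/_ k 2 ∸ j)))
                    (upTo (suc (ℕ._/_ k 2))))

Fbar₋₁ : ℤ → ℤ
Fbar₋₁ x = + 0

𝓕 : ℕ → ℕ → ℤ
𝓕 n k = (+ n) ℤ.^ (ℕ._%_ k 2) ℤ.* Fbar k (+ (n ℕ.* n))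

𝓕₋₁ : ℕ → ℤ
𝓕₋₁ n = (+ n) ℤ.^ 1 ℤ.* Fbar₋₁ (+ (n ℕ.* n))

ℛ : ℕ → ℕ → List ℤ
ℛ n k = map (λ i → - (+ (k ℕ.* (n ∸ 1))) ℤ.+ + (2 ℕ.* i)) (upTo (suc (k ℕ.* (n ∸ 1))))

_∈ᵇ_ : ℤ → List ℤ → Bool
r ∈ᵇ rs = any (λ s → ⌊ r ℤ.≟ s ⌋) rs

a : ℕ → ℕ → ℤ → ℤ
a n zero          r = if ⌊ r ℤ.≟ + 0 ⌋ then + 1 else + 0
a n (suc zero)    r = if r ∈ᵇ ℛ n 1 then + 1 else + 0
a n (suc (suc k)) r =
  if r ∈ᵇ ℛ n (suc (suc k))
  then sum (map (λ s → a n (suc k) (r ℤ.+ s)) (ℛ n 1)) - a n k r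
  else + 0

-- A^{(n)}_k(x) = Σ_{r ∈ ℛ_{n,k}} a_{k,r} x^{(k(n-1)-r)/2};
-- writing r = -k(n-1) + 2i, the exponent is k(n-1) - i.
A : ℕ → ℕ → ℤ → ℤ
A n k x = sum (map (λ i → a n k (- (+ (k ℕ.* (n ∸ 1))) ℤ.+ + (2 ℕ.* i))
                           ℤ.* (x ℤ.^ (k ℕ.* (n ∸ 1) ∸ i)))
                   (upTo (suc (k ℕ.* (n ∸ 1)))))

A₋₁ : ℕ → ℤ → ℤ
A₋₁ n x = + 0

𝓐 : ℕ → ℕ → ℤ
𝓐 n k = A n k (+ 1)

𝓐₋₁ : ℕ → ℤ
𝓐₋₁ n = A₋₁ n (+ 1)

-- The recurrence X_{n,k} = n X_{n,k-1} - X_{n,k-2} for all k ≥ 1,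
-- with X_{n,-1} = 0 and X_{n,0} = 1.  X is given by its values at
-- k ≥ 0 (X n k) and its value at k = -1 (Xm n).

open import Relation.Binary.PropositionalEquality using (_≡_)
open import Data.Product using (_×_)

FibRec : (ℕ → ℕ → ℤ) → (ℕ → ℤ) → ℕ → Set
FibRec X Xm n =
  (Xm n ≡ + 0) ×
  (X n 0 ≡ + 1) ×
  (X n 1 ≡ (+ n) ℤ.* X n 0 - Xm n) ×
  (∀ k → X n (suc (suc k)) ≡ (+ n) ℤ.* X n (suc k) - X n k)

-- All three sequences satisfy X_k = n X_{k-1} - X_{k-2} with X_{-1} = 0 and X_0 = 1, so each
-- equals the Lucas sequence U_{k+1}(n, 1).
-- For 𝓕, Pascal's rule f_{k+2,j+1} = f_{k+1,j+1} + f_{k,j} gives F̄_{k+2} = x F̄_{k+1} - F̄_k for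
-- even k and F̄_{k+2} = F̄_{k+1} - F̄_k for odd k; the factor n^{k mod 2} turns both into the
-- recurrence at x = n².
-- For 𝓛, a tuple is built block by block. After an entry that is not the last one of its
-- block, all n entries of the next block may follow; after the last one, all but the first.
-- Tracking both kinds of prefixes gives the recurrence.
-- For 𝓐, row k of the triangle vanishes outside ℛ_{n,k}, so summing the recurrence for row
-- k + 2 over r yields the sum of row k + 1 once for each of the n shifts s ∈ ℛ_{n,1}.
module Submission where

open import Defs
open import Data.Nat as ℕ using (ℕ; zero; suc; _∸_; _≤_; _<_; _≥_; z≤n; s≤s; _≡ᵇ_)
import Data.Nat.Properties as ℕ
open import Data.Nat.Combinatorics using (_C_; nCk+nC[k+1]≡[n+1]C[k+1]; k>n⇒nCk≡0)
open import Data.Nat.DivMod using (m*n/n≡m; m*n%n≡0; +-distrib-/; [m+kn]%n≡m%n)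
open import Data.Nat.Tactic.RingSolver renaming (solve-∀ to ℕ-solve-∀)
open import Data.Integer as ℤ using (ℤ; +_; -_; _-_; _+_; _*_; _^_)
import Data.Integer.Properties as ℤ
open import Data.Integer.Tactic.RingSolver using (solve-∀)
open import Data.Bool using (Bool; true; false; not; _∧_; if_then_else_; T)
open import Data.Bool.Properties using (if-not)
open import Data.List using (List; []; _∷_; _++_; map; upTo; applyUpTo; filterᵇ; length)
open import Data.List.Properties using (map-∘; map-++; map-cong; map-upTo; map-applyUpTo; upTo-∷ʳ)
open import Data.List.Membership.Propositional using (_∈_)
open import Data.List.Membership.Propositional.Properties using (∈-map⁺; ∈-map⁻; ∈-upTo⁺; ∈-upTo⁻)
open import Data.List.Relation.Unary.Any using (here)
import Data.List.Relation.Unary.Any as Any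
open import Data.List.Relation.Unary.Any.Properties using (any⁺; any⁻)
open import Data.Product using (_×_; _,_; proj₁; proj₂)
open import Data.Sum using (inj₁; inj₂)
open import Data.Unit using (tt)
open import Data.Empty using (⊥-elim)
open import Function using (_∘_)
open import Relation.Nullary using (¬_)
open import Relation.Nullary.Decidable using (toWitness; fromWitness)
open import Relation.Binary.PropositionalEquality

if-T : ∀ {A : Set} {b} {x y : A} → T b → (if b then x else y) ≡ x
if-T {b = true} _ = refl

if-¬T : ∀ {A : Set} {b} {x y : A} → ¬ T b → (if b then x else y) ≡ y
if-¬T {b = true}  ¬b = ⊥-elim (¬b tt)
if-¬T {b = false} _  = refl

sum-++ : ∀ xs ys → sum (xs ++ ys) ≡ sum xs + sum ys
sum-++ []       ys = sym (ℤ.+-identityˡ (sum ys))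
sum-++ (x ∷ xs) ys = trans (cong (_+_ x) (sum-++ xs ys)) (sym (ℤ.+-assoc x (sum xs) (sum ys)))

-- Sums over initial segments of ℕ

∑ : ℕ → (ℕ → ℤ) → ℤ
∑ m f = sum (map f (upTo m))

∑-sucʳ : ∀ m f → ∑ (suc m) f ≡ ∑ m f + f m
∑-sucʳ m f = begin
  sum (map f (upTo (suc m)))          ≡⟨ cong (sum ∘ map f) (upTo-∷ʳ m) ⟨
  sum (map f (upTo m ++ m ∷ []))      ≡⟨ cong sum (map-++ f (upTo m) (m ∷ [])) ⟩
  sum (map f (upTo m) ++ f m ∷ [])    ≡⟨ sum-++ (map f (upTo m)) (f m ∷ []) ⟩
  ∑ m f + (f m + + 0)                 ≡⟨ cong (_+_ (∑ m f)) (ℤ.+-identityʳ (f m)) ⟩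
  ∑ m f + f m                         ∎
  where open ≡-Reasoning

∑-sucˡ : ∀ m f → ∑ (suc m) f ≡ f 0 + ∑ m (f ∘ suc)
∑-sucˡ zero    f = refl
∑-sucˡ (suc m) f = begin
  ∑ (suc (suc m)) f                   ≡⟨ ∑-sucʳ (suc m) f ⟩
  ∑ (suc m) f + f (suc m)             ≡⟨ cong (_+ f (suc m)) (∑-sucˡ m f) ⟩
  f 0 + ∑ m (f ∘ suc) + f (suc m)     ≡⟨ ℤ.+-assoc (f 0) _ _ ⟩
  f 0 + (∑ m (f ∘ suc) + f (suc m))   ≡⟨ cong (_+_ (f 0)) (∑-sucʳ m (f ∘ suc)) ⟨
  f 0 + ∑ (suc m) (f ∘ suc)           ∎
  where open ≡-Reasoning

∑-cong : ∀ m {f g} → (∀ i → i < m → f i ≡ g i) → ∑ m f ≡ ∑ m g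
∑-cong zero    f≗g = refl
∑-cong (suc m) {f} {g} f≗g = begin
  ∑ (suc m) f    ≡⟨ ∑-sucʳ m f ⟩
  ∑ m f + f m    ≡⟨ cong₂ _+_ (∑-cong m (λ i i<m → f≗g i (ℕ.m<n⇒m<1+n i<m))) (f≗g m (ℕ.n<1+n m)) ⟩
  ∑ m g + g m    ≡⟨ ∑-sucʳ m g ⟨
  ∑ (suc m) g    ∎
  where open ≡-Reasoning

∑-const : ∀ m {f} v → (∀ i → i < m → f i ≡ v) → ∑ m f ≡ + m * v
∑-const zero    v f≗v = refl
∑-const (suc m) {f} v f≗v = begin
  ∑ (suc m) f     ≡⟨ ∑-sucʳ m f ⟩
  ∑ m f + f m     ≡⟨ cong₂ _+_ (∑-const m v (λ i i<m → f≗v i (ℕ.m<n⇒m<1+n i<m))) (f≗v m (ℕ.n<1+n m)) ⟩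
  + m * v + v     ≡⟨ lemma (+ m) v ⟩
  + suc m * v     ∎
  where
  open ≡-Reasoning
  lemma : ∀ m v → m * v + v ≡ (+ 1 + m) * v
  lemma = solve-∀

∑-zero : ∀ m {f} → (∀ i → i < m → f i ≡ + 0) → ∑ m f ≡ + 0
∑-zero m f≗0 = trans (∑-const m (+ 0) f≗0) (ℤ.*-zeroʳ (+ m))

∑-+ : ∀ m f g → ∑ m (λ i → f i + g i) ≡ ∑ m f + ∑ m g
∑-+ zero    f g = refl
∑-+ (suc m) f g = begin
  ∑ (suc m) (λ i → f i + g i)         ≡⟨ ∑-sucʳ m _ ⟩
  ∑ m (λ i → f i + g i) + (f m + g m) ≡⟨ cong (_+ (f m + g m)) (∑-+ m f g) ⟩
  ∑ m f + ∑ m g + (f m + g m)         ≡⟨ lemma (∑ m f) (∑ m g) (f m) (g m) ⟩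
  (∑ m f + f m) + (∑ m g + g m)       ≡⟨ cong₂ _+_ (∑-sucʳ m f) (∑-sucʳ m g) ⟨
  ∑ (suc m) f + ∑ (suc m) g           ∎
  where
  open ≡-Reasoning
  lemma : ∀ a b c d → a + b + (c + d) ≡ (a + c) + (b + d)
  lemma = solve-∀

∑-- : ∀ m f g → ∑ m (λ i → f i - g i) ≡ ∑ m f - ∑ m g
∑-- m f g = begin
  ∑ m (λ i → f i - g i)            ≡⟨ ∑-+ m f (λ i → - g i) ⟩
  ∑ m f + ∑ m (λ i → - g i)        ≡⟨ cong (_+_ (∑ m f)) (∑-neg m g) ⟩
  ∑ m f - ∑ m g                    ∎
  where
  open ≡-Reasoning
  ∑-neg : ∀ m g → ∑ m (λ i → - g i) ≡ - ∑ m g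
  ∑-neg zero    g = refl
  ∑-neg (suc m) g = trans (∑-sucʳ m _)
    (trans (cong (_+ - g m) (∑-neg m g))
    (trans (sym (ℤ.neg-distrib-+ (∑ m g) (g m))) (cong -_ (sym (∑-sucʳ m g)))))

∑-+ℕ : ∀ m p f → ∑ (m ℕ.+ p) f ≡ ∑ m f + ∑ p (λ i → f (m ℕ.+ i))
∑-+ℕ m zero    f = trans (cong (λ l → ∑ l f) (ℕ.+-identityʳ m)) (sym (ℤ.+-identityʳ (∑ m f)))
∑-+ℕ m (suc p) f = begin
  ∑ (m ℕ.+ suc p) f                                    ≡⟨ cong (λ l → ∑ l f) (ℕ.+-suc m p) ⟩
  ∑ (suc (m ℕ.+ p)) f                                  ≡⟨ ∑-sucʳ (m ℕ.+ p) f ⟩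
  ∑ (m ℕ.+ p) f + f (m ℕ.+ p)                          ≡⟨ cong (_+ f (m ℕ.+ p)) (∑-+ℕ m p f) ⟩
  ∑ m f + ∑ p (λ i → f (m ℕ.+ i)) + f (m ℕ.+ p)        ≡⟨ ℤ.+-assoc (∑ m f) _ _ ⟩
  ∑ m f + (∑ p (λ i → f (m ℕ.+ i)) + f (m ℕ.+ p))      ≡⟨ cong (_+_ (∑ m f)) (∑-sucʳ p _) ⟨
  ∑ m f + ∑ (suc p) (λ i → f (m ℕ.+ i))                ∎
  where open ≡-Reasoning

∑-comm : ∀ m p (F : ℕ → ℕ → ℤ) → ∑ m (λ i → ∑ p (F i)) ≡ ∑ p (λ t → ∑ m (λ i → F i t))
∑-comm zero    p F = sym (∑-zero p (λ _ _ → refl))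
∑-comm (suc m) p F = begin
  ∑ (suc m) (λ i → ∑ p (F i))                              ≡⟨ ∑-sucʳ m _ ⟩
  ∑ m (λ i → ∑ p (F i)) + ∑ p (F m)                        ≡⟨ cong (_+ ∑ p (F m)) (∑-comm m p F) ⟩
  ∑ p (λ t → ∑ m (λ i → F i t)) + ∑ p (F m)                ≡⟨ ∑-+ p _ (F m) ⟨
  ∑ p (λ t → ∑ m (λ i → F i t) + F m t)                    ≡⟨ ∑-cong p (λ t _ → sym (∑-sucʳ m (λ i → F i t))) ⟩
  ∑ p (λ t → ∑ (suc m) (λ i → F i t))                      ∎
  where open ≡-Reasoning

-- The Lucas sequence U(n, 1); the paper's X_{n,k} is lucasU n (k + 1).
lucasU : ℕ → ℕ → ℤ
lucasU n zero          = + 0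
lucasU n (suc zero)    = + 1
lucasU n (suc (suc k)) = + n * lucasU n (suc k) - lucasU n k

FibRec⇒≡lucasU : ∀ X Xm n → FibRec X Xm n → ∀ k → X n k ≡ lucasU n (suc k)
FibRec⇒≡lucasU X Xm n (_ , X₀ , _ , _) zero = X₀
FibRec⇒≡lucasU X Xm n (Xm≡0 , X₀ , X₁ , _) (suc zero) =
  trans X₁ (cong₂ (λ u v → + n * u - v) X₀ Xm≡0)
FibRec⇒≡lucasU X Xm n rec@(_ , _ , _ , Xrec) (suc (suc k)) =
  trans (Xrec k) (cong₂ (λ u v → + n * u - v)
    (FibRec⇒≡lucasU X Xm n rec (suc k)) (FibRec⇒≡lucasU X Xm n rec k))

≡lucasU⇒FibRec : ∀ X Xm n → Xm n ≡ + 0 → (∀ k → X n k ≡ lucasU n (suc k)) → FibRec X Xm n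
≡lucasU⇒FibRec X Xm n Xm≡0 X≡U =
  Xm≡0 , X≡U 0 , trans (X≡U 1) (sym (cong₂ (λ u v → + n * u - v) (X≡U 0) Xm≡0)) ,
  λ k → trans (X≡U (suc (suc k))) (sym (cong₂ (λ u v → + n * u - v) (X≡U (suc k)) (X≡U k)))

-- The polynomials F̄_k

coeff : ℕ → ℕ → ℤ
coeff k j = sign j * + ((k ∸ j) C j)

descPoly : (ℕ → ℤ) → ℕ → ℤ → ℤ
descPoly f zero    x = f 0
descPoly f (suc M) x = f 0 * x ^ suc M + descPoly (f ∘ suc) M x

∑≡descPoly : ∀ f M x → ∑ (suc M) (λ j → f j * x ^ (M ∸ j)) ≡ descPoly f M x
∑≡descPoly f zero    x = trans (ℤ.+-identityʳ _) (ℤ.*-identityʳ (f 0))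
∑≡descPoly f (suc M) x =
  trans (∑-sucˡ (suc M) (λ j → f j * x ^ (suc M ∸ j)))
        (cong (_+_ (f 0 * x ^ suc M)) (∑≡descPoly (f ∘ suc) M x))

descPoly-cong : ∀ {f g} M x → (∀ j → f j ≡ g j) → descPoly f M x ≡ descPoly g M x
descPoly-cong zero    x f≗g = f≗g 0
descPoly-cong (suc M) x f≗g =
  cong₂ (λ a p → a * x ^ suc M + p) (f≗g 0) (descPoly-cong M x (f≗g ∘ suc))

descPoly-- : ∀ f g M x → descPoly (λ j → f j - g j) M x ≡ descPoly f M x - descPoly g M x
descPoly-- f g zero    x = refl
descPoly-- f g (suc M) x =
  trans (cong (_+_ ((f 0 - g 0) * x ^ suc M)) (descPoly-- (f ∘ suc) (g ∘ suc) M x))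
        (lemma (f 0) (g 0) (x ^ suc M) (descPoly (f ∘ suc) M x) (descPoly (g ∘ suc) M x))
  where
  lemma : ∀ a b y p q → (a - b) * y + (p - q) ≡ (a * y + p) - (b * y + q)
  lemma = solve-∀

descPoly-suc : ∀ f M x → descPoly f (suc M) x ≡ x * descPoly f M x + f (suc M)
descPoly-suc f zero    x = lemma (f 0) x (f 1)
  where
  lemma : ∀ a x b → a * (x * + 1) + b ≡ x * a + b
  lemma = solve-∀
descPoly-suc f (suc M) x =
  trans (cong (_+_ (f 0 * x ^ suc (suc M))) (descPoly-suc (f ∘ suc) M x))
        (lemma (f 0) x (x ^ suc M) (descPoly (f ∘ suc) M x) (f (suc (suc M))))
  where
  lemma : ∀ a x y p b → a * (x * y) + (x * p + b) ≡ x * (a * y + p) + b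
  lemma = solve-∀

sign-suc : ∀ j → sign (suc j) ≡ - sign j
sign-suc zero    = refl
sign-suc (suc j) = trans (sym (ℤ.neg-involutive (sign j))) (cong -_ (sym (sign-suc j)))

-- Pascal's rule holds for f_{k,j} = (k ∸ j) C j also when j > k, where both sides vanish.
pascal∸ : ∀ k j → (suc k ∸ j) C suc j ≡ (k ∸ j) C j ℕ.+ (k ∸ j) C suc j
pascal∸ k j with ℕ.≤-<-connex j k
... | inj₁ j≤k = trans (cong (_C suc j) (ℕ.+-∸-assoc 1 j≤k))
                       (sym (nCk+nC[k+1]≡[n+1]C[k+1] (k ∸ j) j))
pascal∸ k (suc j) | inj₂ k<j
  rewrite ℕ.m≤n⇒m∸n≡0 k<j | ℕ.m≤n⇒m∸n≡0 (ℕ.<⇒≤ k<j) = refl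

coeff-pascal : ∀ k j → coeff (suc (suc k)) (suc j) ≡ coeff (suc k) (suc j) - coeff k j
coeff-pascal k j rewrite sign-suc j | pascal∸ k j | ℤ.pos-+ ((k ∸ j) C j) ((k ∸ j) C suc j) =
  lemma (sign j) (+ ((k ∸ j) C j)) (+ ((k ∸ j) C suc j))
  where
  lemma : ∀ s a b → - s * (a + b) ≡ - s * b - s * a
  lemma = solve-∀

coeff-odd-vanishes : ∀ m → coeff (suc (m ℕ.* 2)) (suc m) ≡ + 0
coeff-odd-vanishes m rewrite ℕ.*-comm m 2 | ℕ.+-identityʳ m | ℕ.m+n∸n≡m m m
  | k>n⇒nCk≡0 (ℕ.n<1+n m) = ℤ.*-zeroʳ (sign (suc m))

descPoly-coeff-rec : ∀ k M x →
  descPoly (coeff (suc (suc k))) (suc M) x ≡ descPoly (coeff (suc k)) (suc M) x - descPoly (coeff k) M x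
descPoly-coeff-rec k M x = begin
  descPoly (coeff (suc (suc k))) (suc M) x
    ≡⟨ cong (_+_ (y * x ^ suc M)) (descPoly-cong M x (coeff-pascal k)) ⟩
  y * x ^ suc M + descPoly (λ j → coeff (suc k) (suc j) - coeff k j) M x
    ≡⟨ cong (_+_ (y * x ^ suc M)) (descPoly-- (coeff (suc k) ∘ suc) (coeff k) M x) ⟩
  y * x ^ suc M + (descPoly (coeff (suc k) ∘ suc) M x - descPoly (coeff k) M x)
    ≡⟨ ℤ.+-assoc (y * x ^ suc M) _ _ ⟨
  descPoly (coeff (suc k)) (suc M) x - descPoly (coeff k) M x
    ∎
  where
  open ≡-Reasoning
  y : ℤ
  y = coeff (suc k) 0

half-even : ∀ m → m ℕ.* 2 ℕ./ 2 ≡ m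
half-even m = m*n/n≡m m 2

half-odd : ∀ m → suc (m ℕ.* 2) ℕ./ 2 ≡ m
half-odd m = trans (+-distrib-/ 1 (m ℕ.* 2) 1%2+[2m]%2<2) (half-even m)
  where
  1%2+[2m]%2<2 : 1 ℕ.% 2 ℕ.+ (m ℕ.* 2) ℕ.% 2 < 2
  1%2+[2m]%2<2 = subst (λ r → 1 ℕ.+ r < 2) (sym (m*n%n≡0 m 2)) ℕ.≤-refl

Fbar≡descPoly : ∀ k {M} x → k ℕ./ 2 ≡ M → Fbar k x ≡ descPoly (coeff k) M x
Fbar≡descPoly k x refl = ∑≡descPoly (coeff k) (k ℕ./ 2) x

Fbar-even : ∀ m x → Fbar (suc m ℕ.* 2) x ≡ x * Fbar (suc (m ℕ.* 2)) x - Fbar (m ℕ.* 2) x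
Fbar-even m x = begin
  Fbar (suc m ℕ.* 2) x
    ≡⟨ Fbar≡descPoly (suc m ℕ.* 2) x (half-even (suc m)) ⟩
  descPoly (coeff (suc m ℕ.* 2)) (suc m) x
    ≡⟨ descPoly-coeff-rec (m ℕ.* 2) m x ⟩
  descPoly c (suc m) x - P₀
    ≡⟨ cong (_- P₀) (descPoly-suc c m x) ⟩
  (x * descPoly c m x + c (suc m)) - P₀
    ≡⟨ cong (λ z → (x * descPoly c m x + z) - P₀) (coeff-odd-vanishes m) ⟩
  (x * descPoly c m x + + 0) - P₀
    ≡⟨ cong (_- P₀) (ℤ.+-identityʳ (x * descPoly c m x)) ⟩
  x * descPoly c m x - P₀
    ≡⟨ cong₂ (λ p q → x * p - q) (Fbar≡descPoly (suc (m ℕ.* 2)) x (half-odd m))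
                                 (Fbar≡descPoly (m ℕ.* 2) x (half-even m)) ⟨
  x * Fbar (suc (m ℕ.* 2)) x - Fbar (m ℕ.* 2) x
    ∎
  where
  open ≡-Reasoning
  c : ℕ → ℤ
  c = coeff (suc (m ℕ.* 2))
  P₀ : ℤ
  P₀ = descPoly (coeff (m ℕ.* 2)) m x

Fbar-odd : ∀ m x → Fbar (suc (suc m ℕ.* 2)) x ≡ Fbar (suc m ℕ.* 2) x - Fbar (suc (m ℕ.* 2)) x
Fbar-odd m x = begin
  Fbar (suc (suc m ℕ.* 2)) x
    ≡⟨ Fbar≡descPoly (suc (suc m ℕ.* 2)) x (half-odd (suc m)) ⟩
  descPoly (coeff (suc (suc m ℕ.* 2))) (suc m) x
    ≡⟨ descPoly-coeff-rec (suc (m ℕ.* 2)) m x ⟩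
  descPoly (coeff (suc m ℕ.* 2)) (suc m) x - descPoly (coeff (suc (m ℕ.* 2))) m x
    ≡⟨ cong₂ _-_ (Fbar≡descPoly (suc m ℕ.* 2) x (half-even (suc m)))
                 (Fbar≡descPoly (suc (m ℕ.* 2)) x (half-odd m)) ⟨
  Fbar (suc m ℕ.* 2) x - Fbar (suc (m ℕ.* 2)) x
    ∎
  where open ≡-Reasoning

data EvenOdd : ℕ → Set where
  even : ∀ m → EvenOdd (m ℕ.* 2)
  odd  : ∀ m → EvenOdd (suc (m ℕ.* 2))

evenOdd : ∀ k → EvenOdd k
evenOdd zero = even 0
evenOdd (suc k) with evenOdd k
... | even m = odd m
... | odd m  = even (suc m)

𝓕-even : ∀ n m → 𝓕 n (m ℕ.* 2) ≡ Fbar (m ℕ.* 2) (+ (n ℕ.* n))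
𝓕-even n m = trans (cong (λ e → (+ n) ^ e * Fbar (m ℕ.* 2) (+ (n ℕ.* n))) (m*n%n≡0 m 2))
                   (ℤ.*-identityˡ _)

𝓕-odd : ∀ n m → 𝓕 n (suc (m ℕ.* 2)) ≡ + n * Fbar (suc (m ℕ.* 2)) (+ (n ℕ.* n))
𝓕-odd n m = trans (cong (λ e → (+ n) ^ e * Fbar (suc (m ℕ.* 2)) (+ (n ℕ.* n))) ([m+kn]%n≡m%n 1 m 2))
                  (cong (_* Fbar (suc (m ℕ.* 2)) (+ (n ℕ.* n))) (ℤ.*-identityʳ (+ n)))

𝓕-rec : ∀ n k → 𝓕 n (suc (suc k)) ≡ + n * 𝓕 n (suc k) - 𝓕 n k
𝓕-rec n k with evenOdd k
... | even m = begin
  𝓕 n (suc m ℕ.* 2)                          ≡⟨ 𝓕-even n (suc m) ⟩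
  Fbar (suc m ℕ.* 2) N                        ≡⟨ Fbar-even m N ⟩
  N * Fbar (suc (m ℕ.* 2)) N - Fbar (m ℕ.* 2) N
    ≡⟨ cong (λ y → y * Fbar (suc (m ℕ.* 2)) N - Fbar (m ℕ.* 2) N) (ℤ.pos-* n n) ⟩
  + n * + n * Fbar (suc (m ℕ.* 2)) N - Fbar (m ℕ.* 2) N
    ≡⟨ cong (_- Fbar (m ℕ.* 2) N) (ℤ.*-assoc (+ n) (+ n) _) ⟩
  + n * (+ n * Fbar (suc (m ℕ.* 2)) N) - Fbar (m ℕ.* 2) N
    ≡⟨ cong₂ (λ p q → + n * p - q) (𝓕-odd n m) (𝓕-even n m) ⟨
  + n * 𝓕 n (suc (m ℕ.* 2)) - 𝓕 n (m ℕ.* 2)  ∎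
  where
  open ≡-Reasoning
  N : ℤ
  N = + (n ℕ.* n)
... | odd m = begin
  𝓕 n (suc (suc m ℕ.* 2))                    ≡⟨ 𝓕-odd n (suc m) ⟩
  + n * Fbar (suc (suc m ℕ.* 2)) N           ≡⟨ cong (+ n *_) (Fbar-odd m N) ⟩
  + n * (Fbar (suc m ℕ.* 2) N - Fbar (suc (m ℕ.* 2)) N)
    ≡⟨ *-distribˡ-- (+ n) _ _ ⟩
  + n * Fbar (suc m ℕ.* 2) N - + n * Fbar (suc (m ℕ.* 2)) N
    ≡⟨ cong₂ (λ p q → + n * p - q) (𝓕-even n (suc m)) (𝓕-odd n m) ⟨
  + n * 𝓕 n (suc m ℕ.* 2) - 𝓕 n (suc (m ℕ.* 2))  ∎
  where
  open ≡-Reasoning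
  N : ℤ
  N = + (n ℕ.* n)
  *-distribˡ-- : ∀ a b c → a * (b - c) ≡ a * b - a * c
  *-distribˡ-- = solve-∀

FibRec-𝓕 : ∀ n → FibRec 𝓕 𝓕₋₁ n
FibRec-𝓕 n = 𝓕₋₁≡0 , refl , 𝓕₁ , 𝓕-rec n
  where
  𝓕₋₁≡0 : 𝓕₋₁ n ≡ + 0
  𝓕₋₁≡0 = ℤ.*-zeroʳ ((+ n) ^ 1)
  𝓕₁ : 𝓕 n 1 ≡ + n * 𝓕 n 0 - 𝓕₋₁ n
  𝓕₁ rewrite 𝓕₋₁≡0 = trans (cong (_* + 1) (ℤ.*-identityʳ (+ n))) (sym (ℤ.+-identityʳ _))

-- Counting L^Fib(n, k)

count : ∀ {A : Set} → (A → Bool) → List A → ℤ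
count p []       = + 0
count p (x ∷ xs) = (if p x then + 1 else + 0) + count p xs

length-filterᵇ : ∀ {A : Set} (p : A → Bool) xs → + length (filterᵇ p xs) ≡ count p xs
length-filterᵇ p []       = refl
length-filterᵇ p (x ∷ xs) with p x
... | true  = cong (_+_ (+ 1)) (length-filterᵇ p xs)
... | false = trans (length-filterᵇ p xs) (sym (ℤ.+-identityˡ _))

count-++ : ∀ {A : Set} (p : A → Bool) xs ys → count p (xs ++ ys) ≡ count p xs + count p ys
count-++ p []       ys = sym (ℤ.+-identityˡ _)
count-++ p (x ∷ xs) ys =
  trans (cong (_+_ c) (count-++ p xs ys)) (sym (ℤ.+-assoc c (count p xs) (count p ys)))
  where
  c : ℤ
  c = if p x then + 1 else + 0

count-map : ∀ {A B : Set} (p : B → Bool) (f : A → B) xs → count p (map f xs) ≡ count (p ∘ f) xs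
count-map p f []       = refl
count-map p f (x ∷ xs) = cong (_+_ (if p (f x) then + 1 else + 0)) (count-map p f xs)

count-∧ : ∀ {A : Set} b (p : A → Bool) xs →
  count (λ x → b ∧ p x) xs ≡ (if b then count p xs else + 0)
count-∧ true  p xs       = refl
count-∧ false p []       = refl
count-∧ false p (x ∷ xs) = trans (ℤ.+-identityˡ _) (count-∧ false p xs)

count-cartesian : ∀ (p : List ℕ → Bool) b bs →
  count p (cartesian (b ∷ bs)) ≡ sum (map (λ y → count (p ∘ (y ∷_)) (cartesian bs)) b)
count-cartesian p []      bs = refl
count-cartesian p (y ∷ b) bs =
  trans (count-++ p (map (y ∷_) (cartesian bs)) _)
        (cong₂ _+_ (count-map p (y ∷_) (cartesian bs)) (count-cartesian p b bs))

blocksFrom : ℕ → ℕ → ℕ → List (List ℕ)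
blocksFrom n j zero    = []
blocksFrom n j (suc k) = block n j ∷ blocksFrom n (suc j) k

map-block≡blocksFrom : ∀ n j k →
  map (λ i → block n (suc (j ℕ.+ i))) (upTo k) ≡ blocksFrom n (suc j) k
map-block≡blocksFrom n j zero    = refl
map-block≡blocksFrom n j (suc k) = cong₂ _∷_ (cong (block n ∘ suc) (ℕ.+-identityʳ j)) (begin
  map f (applyUpTo suc k)                            ≡⟨ map-applyUpTo suc f k ⟩
  applyUpTo (f ∘ suc) k                              ≡⟨ map-upTo (f ∘ suc) k ⟨
  map (f ∘ suc) (upTo k)                             ≡⟨ map-cong (cong (block n ∘ suc) ∘ ℕ.+-suc j) (upTo k) ⟩
  map (λ i → block n (suc (suc j ℕ.+ i))) (upTo k)   ≡⟨ map-block≡blocksFrom n (suc j) k ⟩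
  blocksFrom n (suc (suc j)) k                       ∎)
  where
  open ≡-Reasoning
  f : ℕ → List ℕ
  f i = block n (suc (j ℕ.+ i))

count-cartesian-block : ∀ (p : List ℕ → Bool) n j bs → count p (cartesian (block n (suc j) ∷ bs)) ≡
  ∑ n (λ i → count (λ t → p (j ℕ.* n ℕ.+ suc i ∷ t)) (cartesian bs))
count-cartesian-block p n j bs =
  trans (count-cartesian p (block n (suc j)) bs) (cong sum (sym (map-∘ (upTo n))))

continuations : ℕ → ℕ → ℕ → ℕ → ℤ
continuations n x j k = count (λ t → noSucc (x ∷ t)) (cartesian (blocksFrom n j k))

continuations-suc : ∀ n x j k → continuations n x (suc j) (suc k) ≡
  ∑ n (λ i → if j ℕ.* n ℕ.+ suc i ≡ᵇ suc x then + 0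
             else continuations n (j ℕ.* n ℕ.+ suc i) (suc (suc j)) k)
continuations-suc n x j k =
  trans (count-cartesian-block (λ t → noSucc (x ∷ t)) n j (blocksFrom n (suc (suc j)) k))
        (∑-cong n (λ i _ → trans (count-∧ (not (y i ≡ᵇ suc x)) (λ t → noSucc (y i ∷ t)) tails)
                                 (if-not (y i ≡ᵇ suc x))))
  where
  y : ℕ → ℕ
  y i = j ℕ.* n ℕ.+ suc i
  tails : List (List ℕ)
  tails = cartesian (blocksFrom n (suc (suc j)) k)

𝓛-suc : ∀ n k → 𝓛 n (suc k) ≡ ∑ n (λ i → continuations n (suc i) 2 k)
𝓛-suc n k = begin
  + length (filterᵇ noSucc (boxTuples n (suc k)))
    ≡⟨ length-filterᵇ noSucc (boxTuples n (suc k)) ⟩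
  count noSucc (boxTuples n (suc k))
    ≡⟨ cong (count noSucc ∘ cartesian) (map-block≡blocksFrom n 0 (suc k)) ⟩
  count noSucc (cartesian (blocksFrom n 1 (suc k)))
    ≡⟨ count-cartesian-block noSucc n 0 (blocksFrom n 2 k) ⟩
  ∑ n (λ i → continuations n (suc i) 2 k)
    ∎
  where open ≡-Reasoning

module _ (q : ℕ) where

  private
    n : ℕ
    n = 2 ℕ.+ q

  entry<next-block : ∀ j {i} → i < suc q → j ℕ.* n ℕ.+ suc i < suc j ℕ.* n
  entry<next-block j {i} i<1+q =
    subst (j ℕ.* n ℕ.+ suc i <_) (ℕ.+-comm (j ℕ.* n) n) (ℕ.+-monoʳ-< (j ℕ.* n) (s≤s i<1+q))

  entry≢suc : ∀ j {x} i → x < j ℕ.* n → ¬ T (j ℕ.* n ℕ.+ suc i ≡ᵇ suc x)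
  entry≢suc j {x} i x<jn isSuc = ℕ.<-irrefl refl (ℕ.<-≤-trans (ℕ.m<m+n (j ℕ.* n) (s≤s z≤n))
                                               (ℕ.≤-trans (ℕ.≤-reflexive (ℕ.≡ᵇ⇒≡ _ (suc x) isSuc)) x<jn))

  later-entry≢suc : ∀ j i → ¬ T (j ℕ.* n ℕ.+ suc (suc i) ≡ᵇ suc (j ℕ.* n))
  later-entry≢suc j i isSuc
    with ℕ.+-cancelˡ-≡ (j ℕ.* n) (suc (suc i)) 1
           (trans (ℕ.≡ᵇ⇒≡ _ _ isSuc) (ℕ.+-comm 1 (j ℕ.* n)))
  ... | ()

  -- j n is the last entry of block j: after a smaller entry every extension is admissible,
  -- after j n exactly those starting with j n + 1 are not.
  continuations≡lucasU : ∀ k j →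
    (∀ x → x < j ℕ.* n → continuations n x (suc j) k ≡ lucasU n (suc k)) ×
    (continuations n (j ℕ.* n) (suc j) k ≡ lucasU n (suc k) - lucasU n k)

  ∑-continuations≡lucasU : ∀ k j →
    ∑ n (λ i → continuations n (j ℕ.* n ℕ.+ suc i) (suc (suc j)) k) ≡ lucasU n (suc (suc k))
  ∑-continuations≡lucasU k j = begin
    ∑ n next                                                 ≡⟨ ∑-sucʳ (suc q) next ⟩
    ∑ (suc q) next + next (suc q)
      ≡⟨ cong₂ _+_ (∑-const (suc q) (lucasU n (suc k)) (λ i i<1+q →
                      proj₁ (continuations≡lucasU k (suc j)) _ (entry<next-block j i<1+q)))
                   (trans (cong (λ z → continuations n z (suc (suc j)) k) (ℕ.+-comm (j ℕ.* n) n))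
                          (proj₂ (continuations≡lucasU k (suc j)))) ⟩
    + suc q * lucasU n (suc k) + (lucasU n (suc k) - lucasU n k)
      ≡⟨ lemma (+ q) (lucasU n (suc k)) (lucasU n k) ⟩
    lucasU n (suc (suc k))                                   ∎
    where
    open ≡-Reasoning
    next : ℕ → ℤ
    next i = continuations n (j ℕ.* n ℕ.+ suc i) (suc (suc j)) k
    lemma : ∀ q a b → (+ 1 + q) * a + (a - b) ≡ (+ 1 + (+ 1 + q)) * a - b
    lemma = solve-∀

  continuations≡lucasU zero    j = (λ _ _ → refl) , refl
  continuations≡lucasU (suc k) j = after-inner , after-last
    where
    open ≡-Reasoning
    y : ℕ → ℕ
    y i = j ℕ.* n ℕ.+ suc i
    next : ℕ → ℤ
    next i = continuations n (y i) (suc (suc j)) k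
    after-inner : ∀ x → x < j ℕ.* n → continuations n x (suc j) (suc k) ≡ lucasU n (suc (suc k))
    after-inner x x<jn = begin
      continuations n x (suc j) (suc k)                  ≡⟨ continuations-suc n x j k ⟩
      ∑ n (λ i → if y i ≡ᵇ suc x then + 0 else next i)   ≡⟨ ∑-cong n (λ i _ → if-¬T (entry≢suc j i x<jn)) ⟩
      ∑ n next                                           ≡⟨ ∑-continuations≡lucasU k j ⟩
      lucasU n (suc (suc k))                             ∎
    g : ℕ → ℤ
    g i = if y i ≡ᵇ suc (j ℕ.* n) then + 0 else next i
    after-last : continuations n (j ℕ.* n) (suc j) (suc k) ≡ lucasU n (suc (suc k)) - lucasU n (suc k)
    after-last = begin
      continuations n (j ℕ.* n) (suc j) (suc k)   ≡⟨ continuations-suc n (j ℕ.* n) j k ⟩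
      ∑ n g                                       ≡⟨ ∑-sucˡ (suc q) g ⟩
      g 0 + ∑ (suc q) (g ∘ suc)
        ≡⟨ cong₂ _+_ (if-T (ℕ.≡⇒≡ᵇ (y 0) _ (ℕ.+-comm (j ℕ.* n) 1)))
                     (∑-cong (suc q) (λ i _ → if-¬T (later-entry≢suc j i))) ⟩
      + 0 + ∑ (suc q) (next ∘ suc)                ≡⟨ lemma (next 0) (∑ (suc q) (next ∘ suc)) ⟩
      (next 0 + ∑ (suc q) (next ∘ suc)) - next 0
        ≡⟨ cong₂ _-_ (trans (sym (∑-sucˡ (suc q) next)) (∑-continuations≡lucasU k j))
                     (proj₁ (continuations≡lucasU k (suc j)) (y 0) (entry<next-block j (s≤s z≤n))) ⟩
      lucasU n (suc (suc k)) - lucasU n (suc k)   ∎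
      where
      lemma : ∀ a s → + 0 + s ≡ (a + s) - a
      lemma = solve-∀

  𝓛≡lucasU : ∀ k → 𝓛 n k ≡ lucasU n (suc k)
  𝓛≡lucasU zero    = refl
  𝓛≡lucasU (suc k) = trans (𝓛-suc n k) (∑-continuations≡lucasU k 0)

-- The symmetric Fibonacci triangle

∈ᵇ⇒∈ : ∀ {r} rs → T (r ∈ᵇ rs) → r ∈ rs
∈ᵇ⇒∈ rs r∈ᵇrs = Any.map toWitness (any⁻ _ rs r∈ᵇrs)

∈⇒∈ᵇ : ∀ {r rs} → r ∈ rs → T (r ∈ᵇ rs)
∈⇒∈ᵇ {r} r∈rs = any⁺ _ (Any.map (λ {s} → fromWitness {a? = r ℤ.≟ s}) r∈rs)

a-support : ∀ n k r → ¬ r ∈ ℛ n k → a n k r ≡ + 0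
a-support n zero          r r∉ℛ = if-¬T (λ r≟0 → r∉ℛ (here (toWitness {a? = r ℤ.≟ + 0} r≟0)))
a-support n (suc zero)    r r∉ℛ = if-¬T (r∉ℛ ∘ ∈ᵇ⇒∈ (ℛ n 1))
a-support n (suc (suc k)) r r∉ℛ = if-¬T (r∉ℛ ∘ ∈ᵇ⇒∈ (ℛ n (suc (suc k))))

∑-negatives≡0 : ∀ (f : ℤ → ℤ) → (∀ j → f (- + suc j) ≡ + 0) → ∀ u → ∑ u (λ i → f (- + u + + i)) ≡ + 0
∑-negatives≡0 f f⁻≡0 zero    = refl
∑-negatives≡0 f f⁻≡0 (suc u) = begin
  ∑ (suc u) (λ i → f (- + suc u + + i))
    ≡⟨ ∑-sucˡ u (λ i → f (- + suc u + + i)) ⟩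
  f (- + suc u + + 0) + ∑ u (λ i → f (- + suc u + + suc i))
    ≡⟨ cong₂ _+_ (trans (cong f (ℤ.+-identityʳ _)) (f⁻≡0 u))
                 (∑-cong u (λ i _ → cong f (lemma (+ u) (+ i)))) ⟩
  + 0 + ∑ u (λ i → f (- + u + + i))
    ≡⟨ cong (_+_ (+ 0)) (∑-negatives≡0 f f⁻≡0 u) ⟩
  + 0 ∎
  where
  open ≡-Reasoning
  lemma : ∀ u i → - (+ 1 + u) + (+ 1 + i) ≡ - u + i
  lemma = solve-∀

-- The window [-u, K + t] contains [0, K], outside of which f vanishes.
∑-window : ∀ (f : ℤ → ℤ) K → (∀ j → f (- + suc j) ≡ + 0) → (∀ j → f (+ (suc K ℕ.+ j)) ≡ + 0) →
  ∀ u t → ∑ (u ℕ.+ (suc K ℕ.+ t)) (λ i → f (- + u + + i)) ≡ ∑ (suc K) (λ i → f (+ i))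
∑-window f K f⁻≡0 f⁺≡0 u t = begin
  ∑ (u ℕ.+ (suc K ℕ.+ t)) (λ i → f (- + u + + i))
    ≡⟨ ∑-+ℕ u (suc K ℕ.+ t) (λ i → f (- + u + + i)) ⟩
  ∑ u (λ i → f (- + u + + i)) + ∑ (suc K ℕ.+ t) (λ i → f (- + u + + (u ℕ.+ i)))
    ≡⟨ cong₂ _+_ (∑-negatives≡0 f f⁻≡0 u) (∑-cong (suc K ℕ.+ t) (λ i _ → cong f (cancel u i))) ⟩
  + 0 + ∑ (suc K ℕ.+ t) (λ i → f (+ i))
    ≡⟨ ℤ.+-identityˡ _ ⟩
  ∑ (suc K ℕ.+ t) (λ i → f (+ i))
    ≡⟨ ∑-+ℕ (suc K) t (λ i → f (+ i)) ⟩
  ∑ (suc K) (λ i → f (+ i)) + ∑ t (λ i → f (+ (suc K ℕ.+ i)))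
    ≡⟨ cong (_+_ (∑ (suc K) (λ i → f (+ i)))) (∑-zero t (λ i _ → f⁺≡0 i)) ⟩
  ∑ (suc K) (λ i → f (+ i)) + + 0
    ≡⟨ ℤ.+-identityʳ _ ⟩
  ∑ (suc K) (λ i → f (+ i)) ∎
  where
  open ≡-Reasoning
  cancel : ∀ u i → - + u + + (u ℕ.+ i) ≡ + i
  cancel u i = trans (cong (_+_ (- + u)) (ℤ.pos-+ u i)) (lemma (+ u) (+ i))
    where
    lemma : ∀ u i → - u + (u + i) ≡ i
    lemma = solve-∀

module _ (d : ℕ) where

  private
    n : ℕ
    n = suc d

  -- Row k of the triangle re-indexed by r = -k(n-1) + 2z, so that ℛ_{n,k} becomes z ∈ [0, k(n-1)].
  row : ℕ → ℤ → ℤ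
  row k z = a n k (- + (k ℕ.* d) + + 2 * z)

  index∈ℛ : ∀ k {i} → i ≤ k ℕ.* d → - + (k ℕ.* d) + + 2 * + i ∈ ℛ n k
  index∈ℛ k {i} i≤K =
    subst (λ w → - + (k ℕ.* d) + w ∈ ℛ n k) (ℤ.pos-* 2 i) (∈-map⁺ _ (∈-upTo⁺ (s≤s i≤K)))

  row-vanishes : ∀ k z → (∀ i → i ≤ k ℕ.* d → z ≢ + i) → row k z ≡ + 0
  row-vanishes k z z∉[0,K] = a-support n k _ λ r∈ℛ →
    let (i , i∈upTo , r≡) = ∈-map⁻ _ r∈ℛ in
    z∉[0,K] i (ℕ.≤-pred (∈-upTo⁻ i∈upTo))
      (ℤ.*-cancelˡ-≡ (+ 2) z (+ i) (trans (cancel (+ (k ℕ.* d)) r≡) (ℤ.pos-* 2 i)))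
    where
    cancel : ∀ K {x y} → - K + x ≡ - K + y → x ≡ y
    cancel K {x} {y} e = trans (sym (lemma K x)) (trans (cong (_+_ K) e) (lemma K y))
      where
      lemma : ∀ K x → K + (- K + x) ≡ x
      lemma = solve-∀

  row-vanishes⁻ : ∀ k j → row k (- + suc j) ≡ + 0
  row-vanishes⁻ k j = row-vanishes k _ (λ _ _ ())

  row-vanishes⁺ : ∀ k j → row k (+ (suc (k ℕ.* d) ℕ.+ j)) ≡ + 0
  row-vanishes⁺ k j = row-vanishes k _ (λ i i≤K e →
    ℕ.<-irrefl (sym (ℤ.+-injective e)) (ℕ.<-≤-trans (s≤s i≤K) (ℕ.m≤m+n (suc (k ℕ.* d)) j)))

  𝓐≡∑row : ∀ k → 𝓐 n k ≡ ∑ (suc (k ℕ.* d)) (λ i → row k (+ i))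
  𝓐≡∑row k = ∑-cong (suc (k ℕ.* d)) λ i _ →
    trans (cong (_*_ (a n k (- + (k ℕ.* d) + + (2 ℕ.* i)))) (ℤ.^-zeroˡ (k ℕ.* d ∸ i)))
    (trans (ℤ.*-identityʳ _) (cong (λ w → a n k (- + (k ℕ.* d) + w)) (ℤ.pos-* 2 i)))

  𝓐₁ : 𝓐 n 1 ≡ + n * 𝓐 n 0 - 𝓐₋₁ n
  𝓐₁ = begin
    𝓐 n 1                           ≡⟨ 𝓐≡∑row 1 ⟩
    ∑ (suc (1 ℕ.* d)) (λ i → row 1 (+ i))
      ≡⟨ ∑-const (suc (1 ℕ.* d)) (+ 1) (λ i i<1+d → if-T (∈⇒∈ᵇ (index∈ℛ 1 (ℕ.≤-pred i<1+d)))) ⟩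
    + suc (1 ℕ.* d) * + 1            ≡⟨ cong (λ m → + suc m * + 1) (ℕ.*-identityˡ d) ⟩
    + n * + 1                        ≡⟨ ℤ.+-identityʳ _ ⟨
    + n * 𝓐 n 0 - 𝓐₋₁ n             ∎
    where open ≡-Reasoning

  row-rec : ∀ k i → i ≤ suc (suc k) ℕ.* d →
    row (suc (suc k)) (+ i) ≡ ∑ n (λ t → row (suc k) (+ t - + d + + i)) - row k (- + d + + i)
  row-rec k i i≤K = begin
    row (suc (suc k)) (+ i)
      ≡⟨ if-T (∈⇒∈ᵇ (index∈ℛ (suc (suc k)) i≤K)) ⟩
    sum (map (λ s → a n (suc k) (r + s)) (ℛ n 1)) - a n k r
      ≡⟨ cong (λ s → sum s - a n k r)
              (map-∘ {g = λ s → a n (suc k) (r + s)} (upTo (suc (1 ℕ.* d)))) ⟨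
    ∑ (suc (1 ℕ.* d)) (λ t → a n (suc k) (r + (- + (1 ℕ.* d) + + (2 ℕ.* t)))) - a n k r
      ≡⟨ cong (λ e → ∑ (suc e) (λ t → a n (suc k) (r + (- + e + + (2 ℕ.* t)))) - a n k r)
              (ℕ.*-identityˡ d) ⟩
    ∑ n (λ t → a n (suc k) (r + (- + d + + (2 ℕ.* t)))) - a n k r
      ≡⟨ cong₂ _-_ (∑-cong n (λ t _ → cong (a n (suc k)) (shift₁ t))) (cong (a n k) shift₀) ⟩
    ∑ n (λ t → row (suc k) (+ t - + d + + i)) - row k (- + d + + i)
      ∎
    where
    open ≡-Reasoning
    D K r : ℤ
    D = + d
    K = + (k ℕ.* d)
    r = - + (suc (suc k) ℕ.* d) + + 2 * + i
    K₂≡ : + (suc (suc k) ℕ.* d) ≡ D + (D + K)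
    K₂≡ = trans (ℤ.pos-+ d (suc k ℕ.* d)) (cong (_+_ D) (ℤ.pos-+ d (k ℕ.* d)))
    shift₁ : ∀ t → r + (- D + + (2 ℕ.* t)) ≡ - + (suc k ℕ.* d) + + 2 * (+ t - D + + i)
    shift₁ t = begin
      r + (- D + + (2 ℕ.* t))
        ≡⟨ cong₂ (λ K₂ w → - K₂ + + 2 * + i + (- D + w)) K₂≡ (ℤ.pos-* 2 t) ⟩
      - (D + (D + K)) + + 2 * + i + (- D + + 2 * + t)
        ≡⟨ lemma D K (+ i) (+ t) ⟩
      - (D + K) + + 2 * (+ t - D + + i)
        ≡⟨ cong (λ K₁ → - K₁ + + 2 * (+ t - D + + i)) (ℤ.pos-+ d (k ℕ.* d)) ⟨
      - + (suc k ℕ.* d) + + 2 * (+ t - D + + i)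
        ∎
      where
      lemma : ∀ D K i t → - (D + (D + K)) + + 2 * i + (- D + + 2 * t) ≡ - (D + K) + + 2 * (t - D + i)
      lemma = solve-∀
    shift₀ : r ≡ - K + + 2 * (- D + + i)
    shift₀ = trans (cong (λ K₂ → - K₂ + + 2 * + i) K₂≡) (lemma D K (+ i))
      where
      lemma : ∀ D K i → - (D + (D + K)) + + 2 * i ≡ - K + + 2 * (- D + i)
      lemma = solve-∀

  ∑row-window : ∀ k u t → ∑ (u ℕ.+ (suc (k ℕ.* d) ℕ.+ t)) (λ i → row k (- + u + + i)) ≡ 𝓐 n k
  ∑row-window k u t =
    trans (∑-window (row k) (k ℕ.* d) (row-vanishes⁻ k) (row-vanishes⁺ k) u t) (sym (𝓐≡∑row k))

  ∑row-offset : ∀ k t → t ≤ d → ∑ (suc (d ℕ.+ k ℕ.* d)) (λ i → row k (+ t - + d + + i)) ≡ 𝓐 n k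
  ∑row-offset k t t≤d = begin
    ∑ (suc (d ℕ.+ k ℕ.* d)) (λ i → row k (+ t - + d + + i))
      ≡⟨ cong₂ (λ m lo → ∑ m (λ i → row k (lo + + i))) size offset ⟩
    ∑ (u ℕ.+ (suc (k ℕ.* d) ℕ.+ t)) (λ i → row k (- + u + + i))
      ≡⟨ ∑row-window k u t ⟩
    𝓐 n k ∎
    where
    open ≡-Reasoning
    u : ℕ
    u = d ∸ t
    u+t≡d : u ℕ.+ t ≡ d
    u+t≡d = ℕ.m∸n+n≡m t≤d
    size : suc (d ℕ.+ k ℕ.* d) ≡ u ℕ.+ (suc (k ℕ.* d) ℕ.+ t)
    size = trans (cong (λ w → suc (w ℕ.+ k ℕ.* d)) (sym u+t≡d)) (lemma u t (k ℕ.* d))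
      where
      lemma : ∀ u t K → suc (u ℕ.+ t ℕ.+ K) ≡ u ℕ.+ (suc K ℕ.+ t)
      lemma = ℕ-solve-∀
    offset : + t - + d ≡ - + u
    offset = trans (cong (λ w → + t - + w) (sym u+t≡d))
                   (trans (cong (λ w → + t - w) (ℤ.pos-+ u t)) (lemma (+ u) (+ t)))
      where
      lemma : ∀ u t → t - (u + t) ≡ - u
      lemma = solve-∀

  𝓐-rec : ∀ k → 𝓐 n (suc (suc k)) ≡ + n * 𝓐 n (suc k) - 𝓐 n k
  𝓐-rec k = begin
    𝓐 n (suc (suc k))
      ≡⟨ 𝓐≡∑row (suc (suc k)) ⟩
    ∑ (suc K₂) (λ i → row (suc (suc k)) (+ i))
      ≡⟨ ∑-cong (suc K₂) (λ i i≤K₂ → row-rec k i (ℕ.≤-pred i≤K₂)) ⟩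
    ∑ (suc K₂) (λ i → ∑ n (λ t → shifted t i) - lower i)
      ≡⟨ ∑-- (suc K₂) (λ i → ∑ n (λ t → shifted t i)) lower ⟩
    ∑ (suc K₂) (λ i → ∑ n (λ t → shifted t i)) - ∑ (suc K₂) lower
      ≡⟨ cong (_- ∑ (suc K₂) lower) (∑-comm (suc K₂) n (λ i t → shifted t i)) ⟩
    ∑ n (λ t → ∑ (suc K₂) (shifted t)) - ∑ (suc K₂) lower
      ≡⟨ cong₂ _-_ (∑-const n (𝓐 n (suc k)) (λ t t<n → ∑row-offset (suc k) t (ℕ.≤-pred t<n)))
                   (trans (cong (λ m → ∑ m lower) (lemma d (k ℕ.* d))) (∑row-window k d d)) ⟩
    + n * 𝓐 n (suc k) - 𝓐 n k
      ∎
    where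
    open ≡-Reasoning
    K₂ : ℕ
    K₂ = suc (suc k) ℕ.* d
    shifted : ℕ → ℕ → ℤ
    shifted t i = row (suc k) (+ t - + d + + i)
    lower : ℕ → ℤ
    lower i = row k (- + d + + i)
    lemma : ∀ d K → suc (d ℕ.+ (d ℕ.+ K)) ≡ d ℕ.+ (suc K ℕ.+ d)
    lemma = ℕ-solve-∀

  FibRec-𝓐 : FibRec 𝓐 𝓐₋₁ n
  FibRec-𝓐 = refl , refl , 𝓐₁ , 𝓐-rec

theorem2p2 : (n : ℕ) → n ≥ 2 →
    FibRec 𝓛 𝓛₋₁ n × FibRec 𝓕 𝓕₋₁ n × FibRec 𝓐 𝓐₋₁ n ×
    (∀ (k : ℕ) → k ≥ 1 → (𝓛 n k ≡ 𝓕 n k) × (𝓕 n k ≡ 𝓐 n k))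
theorem2p2 (suc zero) (s≤s ())
theorem2p2 (suc (suc q)) _ =
  FibRec-𝓛 , FibRec-𝓕 n , FibRec-𝓐 (suc q) ,
  λ k _ → trans (𝓛≡lucasU q k) (sym (𝓕≡lucasU k)) , trans (𝓕≡lucasU k) (sym (𝓐≡lucasU k))
  where
  n : ℕ
  n = suc (suc q)
  FibRec-𝓛 : FibRec 𝓛 𝓛₋₁ n
  FibRec-𝓛 = ≡lucasU⇒FibRec 𝓛 𝓛₋₁ n refl (𝓛≡lucasU q)
  𝓕≡lucasU : ∀ k → 𝓕 n k ≡ lucasU n (suc k)
  𝓕≡lucasU = FibRec⇒≡lucasU 𝓕 𝓕₋₁ n (FibRec-𝓕 n)
  𝓐≡lucasU : ∀ k → 𝓐 n k ≡ lucasU n (suc k)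
  𝓐≡lucasU = FibRec⇒≡lucasU 𝓐 𝓐₋₁ n (FibRec-𝓐 (suc q))
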